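{- Let $G=(V,E)$ be a finite simple graph, let $\beta$ be a solution to the Naji system for $G$ that is not chordal, and let $H$ be an induced subgraph of $G$ isomorphic to $K_4$ or to the claw $K_{1,3}$ such that the restriction of $\beta$ to $V(H)$ is not chordal. Let $(X,Y)$ be a split in $H$. Then there is a split $(X',Y')$ in $G$ with $X\subseteq X'$ and $Y\subseteq Y'$.
   Context: The Naji system of a graph $G$ has unknowns $\beta(u,v)\in\mathbb{F}_2$ for each ordered pair of distinct vertices, and equations: $\beta(v,w)+\beta(w,v)=1$ for each edge $vw$; $\beta(x,v)+\beta(x,w)=0$ for each triple of distinct vertices $(x,v,w)$ with $vw\in E$, $xv,xw\notin E$; $\beta(v,w)+\beta(w,v)+\beta(x,v)+\beta(x,w)=1$ for each triple of distinct vertices $(x,v,w)$ with $xv,xw\in E$, $vw\notin E$. An oriented chord diagram is a circle with finitely many oriented chords (each with a tail and a head) having pairwise distinct endpoints. For an oriented chord diagram $\vec{\mathcal C}$ whose intersection graph is $G$ (chords identified with vertices, adjacent iff crossing), $\beta_{\vec{\mathcal C}}(v,w)=0$ if the head of $w$ is encountered travelling clockwise from the head of $v$ to the tail of $v$, and $1$ otherwise. A solution $\beta$ is chordal if $\beta=\beta_{\vec{\mathcal C}}$ for some such oriented chord diagram. A split in a graph is a partition $(X,Y)$ of its vertex set with $|X|,|Y|\ge 2$ such that the set of edges between $X$ and $Y$ induces a complete bipartite graph (i.e., there are $X_0\subseteq X$, $Y_0\subseteq Y$ such that an $X$–$Y$ pair is adjacent iff it lies in $X_0\times Y_0$). -}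

module Defs where

open import Data.Nat using (ℕ; _<ᵇ_)
open import Data.Fin using (Fin; zero; suc)
open import Data.Bool using (Bool; true; false; _xor_; _∧_; _∨_; not; if_then_else_)
open import Data.Product using (Σ; ∃; _×_; _,_)
open import Relation.Binary.PropositionalEquality using (_≡_; _≢_)
open import Relation.Nullary using (¬_)
open import Function.Bundles using (_⇔_)

record Graph (n : ℕ) : Set where
  field
    adj   : Fin n → Fin n → Bool
    sym   : ∀ v w → adj v w ≡ adj w v
    irref : ∀ v → adj v v ≡ false
open Graph public

record Iso {n m : ℕ} (G : Graph n) (H : Graph m) : Set where
  field
    to      : Fin n → Fin m
    from    : Fin m → Fin n
    to-from : ∀ y → to (from y) ≡ y
    from-to : ∀ x → from (to x) ≡ x
    preserves : ∀ v w → adj H (to v) (to w) ≡ adj G v w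

K4 : Graph 4
K4 = record { adj = a ; sym = s ; irref = i }
  where
  a : Fin 4 → Fin 4 → Bool
  a zero zero = false
  a (suc x) (suc y) = a' x y
    where
    a' : Fin 3 → Fin 3 → Bool
    a' zero zero = false
    a' (suc zero) (suc zero) = false
    a' (suc (suc zero)) (suc (suc zero)) = false
    a' _ _ = true
  a _ _ = true
  s : ∀ v w → a v w ≡ a w v
  s zero zero = _≡_.refl
  s zero (suc w) = _≡_.refl
  s (suc v) zero = _≡_.refl
  s (suc zero) (suc zero) = _≡_.refl
  s (suc zero) (suc (suc zero)) = _≡_.refl
  s (suc zero) (suc (suc (suc zero))) = _≡_.refl
  s (suc (suc zero)) (suc zero) = _≡_.refl
  s (suc (suc zero)) (suc (suc zero)) = _≡_.refl
  s (suc (suc zero)) (suc (suc (suc zero))) = _≡_.refl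
  s (suc (suc (suc zero))) (suc zero) = _≡_.refl
  s (suc (suc (suc zero))) (suc (suc zero)) = _≡_.refl
  s (suc (suc (suc zero))) (suc (suc (suc zero))) = _≡_.refl
  i : ∀ v → a v v ≡ false
  i zero = _≡_.refl
  i (suc zero) = _≡_.refl
  i (suc (suc zero)) = _≡_.refl
  i (suc (suc (suc zero))) = _≡_.refl

Claw : Graph 4
Claw = record { adj = a ; sym = s ; irref = i }
  where
  a : Fin 4 → Fin 4 → Bool
  a zero (suc _) = true
  a (suc _) zero = true
  a _ _ = false
  s : ∀ v w → a v w ≡ a w v
  s zero zero = _≡_.refl
  s zero (suc w) = _≡_.refl
  s (suc v) zero = _≡_.refl
  s (suc v) (suc w) = _≡_.refl
  i : ∀ v → a v v ≡ false
  i zero = _≡_.refl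
  i (suc v) = _≡_.refl

Injective : ∀ {k n} → (Fin k → Fin n) → Set
Injective f = ∀ x y → f x ≡ f y → x ≡ y

induced : ∀ {k n} → Graph n → (Fin k → Fin n) → Graph k
induced G f = record
  { adj = λ x y → adj G (f x) (f y)
  ; sym = λ x y → sym G (f x) (f y)
  ; irref = λ x → irref G (f x) }

-- Solutions of the Naji system (F₂ = Bool, + = xor).  β v v is unused.
record NajiSolution {n : ℕ} (G : Graph n) (β : Fin n → Fin n → Bool) : Set where
  field
    eq1 : ∀ v w → adj G v w ≡ true → (β v w xor β w v) ≡ true
    eq2 : ∀ x v w → x ≢ v → x ≢ w → v ≢ w →
          adj G v w ≡ true → adj G x v ≡ false → adj G x w ≡ false →
          (β x v xor β x w) ≡ false
    eq3 : ∀ x v w → x ≢ v → x ≢ w → v ≢ w →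
          adj G x v ≡ true → adj G x w ≡ true → adj G v w ≡ false →
          ((β v w xor β w v) xor (β x v xor β x w)) ≡ true

-- Endpoints are points
-- of the circle, encoded as natural numbers; the clockwise order on the circle
-- is the cyclic order of increasing numbers.
record OCD (n : ℕ) : Set where
  field
    tail : Fin n → ℕ
    head : Fin n → ℕ
    tail-inj : ∀ v w → tail v ≡ tail w → v ≡ w
    head-inj : ∀ v w → head v ≡ head w → v ≡ w
    tail≢head : ∀ v w → tail v ≢ head w
open OCD public

-- p lies strictly inside the clockwise arc from a to b.
inArc : ℕ → ℕ → ℕ → Bool
inArc a b p = if a <ᵇ b then ((a <ᵇ p) ∧ (p <ᵇ b)) else ((a <ᵇ p) ∨ (p <ᵇ b))

crosses : ∀ {n} → OCD n → Fin n → Fin n → Bool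
crosses D v w = inArc (head D v) (tail D v) (head D w) xor inArc (head D v) (tail D v) (tail D w)

HasIntersectionGraph : ∀ {n} → OCD n → Graph n → Set
HasIntersectionGraph D G = ∀ v w → adj G v w ≡ crosses D v w

βC : ∀ {n} → OCD n → Fin n → Fin n → Bool
βC D v w = not (inArc (head D v) (tail D v) (head D w))

Chordal : ∀ {n} → Graph n → (Fin n → Fin n → Bool) → Set
Chordal {n} G β = Σ (OCD n) λ D → HasIntersectionGraph D G × (∀ v w → v ≢ w → β v w ≡ βC D v w)

-- A split: side v ≡ true means v ∈ X, false means v ∈ Y.
record Split {n : ℕ} (G : Graph n) (side : Fin n → Bool) : Set where
  field
    x₁ x₂ y₁ y₂ : Fin n
    x₁≢x₂ : x₁ ≢ x₂
    y₁≢y₂ : y₁ ≢ y₂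
    x₁∈X : side x₁ ≡ true
    x₂∈X : side x₂ ≡ true
    y₁∈Y : side y₁ ≡ false
    y₂∈Y : side y₂ ≡ false
    X₀ Y₀ : Fin n → Bool
    complete : ∀ x y → side x ≡ true → side y ≡ false →
               (adj G x y ≡ true) ⇔ ((X₀ x ∧ Y₀ y) ≡ true)

-- Since β is not chordal on H, a search through all 2¹² possible restrictions of a Naji
-- solution to H shows that, after relabelling H by an automorphism, possibly complementing β
-- and exchanging X and Y, the restriction of β and the split (X, Y) of H form one of five
-- explicit configurations, one for K4 and four for the claw; every other Naji solution on H is
-- realized by an oriented chord diagram.
--
-- For each configuration, a fixed rule assigns every vertex v of G to X or Y according to
-- its incoming profile (β(h, v)) over h ∈ H.  The Naji equations on H together with one further
-- vertex admit only finitely many profiles, and those on H together with two further vertices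
-- x ∈ X and y ∈ Y force xy to be an edge exactly when x is adjacent to a fixed y₀ ∈ Y ∩ H and
-- y to a fixed x₀ ∈ X ∩ H.  So the neighbourhoods of y₀ and x₀ supply X₀ and Y₀, and all
-- that remains is a finite check.

module Submission where

open import Defs hiding (sym)
open import Data.Bool using (Bool; true; false; not; _∧_; _xor_; if_then_else_)
open import Data.Bool.Properties
  using (∧-comm; xor-assoc; xor-same; xor-annihilates-not; not-injective; ¬-not) renaming (_≟_ to _≟ᵇ_)
open import Data.Fin using (Fin; zero; suc; _≟_; toℕ; combine; punchIn; punchOut)
open import Data.Fin.Patterns using (0F; 1F; 2F)
open import Data.Fin.Properties using (all?; any?; punchIn-punchOut)
open import Data.List using (List; []; _∷_; map; filter; concatMap; allFin; cartesianProduct; cartesianProductWith)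
open import Data.List.Membership.Propositional using (_∈_)
open import Data.List.Membership.Propositional.Properties using (∈-filter⁺; ∈-cartesianProductWith⁺; ∈-cartesianProduct⁺)
open import Data.List.Relation.Unary.All as All using (All)
open import Data.List.Relation.Unary.Any as Any using (Any; here; there)
open import Data.Nat using (ℕ; zero; suc; _+_; _∸_; _^_)
import Data.Nat as ℕ
open import Data.Product using (Σ; ∃; ∃₂; _×_; _,_; proj₁; proj₂)
open import Data.Sum as Sum using (_⊎_; inj₁; inj₂)
open import Data.Vec using (Vec; []; _∷_; lookup; tabulate; insertAt)
open import Data.Vec.Properties using (lookup∘tabulate; tabulate-cong; insertAt-punchIn)
open import Function using (_∘_; mk⇔)
open import Relation.Binary.PropositionalEquality
  using (_≡_; _≢_; refl; sym; trans; cong; cong₂; subst; module ≡-Reasoning)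
open import Relation.Nullary using (¬_; Dec; yes; no; does; ¬?; contradiction)
open import Relation.Nullary.Decidable using (map′; _×-dec_; _→-dec_; _⊎-dec_)

allVecs : {A : Set} → List A → ∀ n → List (Vec A n)
allVecs xs zero    = [] ∷ []
allVecs xs (suc n) = cartesianProductWith _∷_ xs (allVecs xs n)

∈-allVecs : {A : Set} {xs : List A} → (∀ x → x ∈ xs) → ∀ {n} (v : Vec A n) → v ∈ allVecs xs n
∈-allVecs ∈xs []       = here refl
∈-allVecs ∈xs (x ∷ v) = ∈-cartesianProductWith⁺ _∷_ (∈xs x) (∈-allVecs ∈xs v)

bools : List Bool
bools = true ∷ false ∷ []

∈-bools : ∀ b → b ∈ bools
∈-bools true  = here refl
∈-bools false = there (here refl)

allBoolVecs : ∀ n → List (Vec Bool n)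
allBoolVecs = allVecs bools

∈-allBoolVecs : ∀ {n} (v : Vec Bool n) → v ∈ allBoolVecs n
∈-allBoolVecs = ∈-allVecs ∈-bools

all-allVecs : {A : Set} {xs : List A} → (∀ x → x ∈ xs) → ∀ {n} {P : Vec A n → Set} →
  All P (allVecs xs n) → ∀ v → P v
all-allVecs ∈xs ps v = All.lookup ps (∈-allVecs ∈xs v)

all-Bool? : {P : Bool → Set} → (∀ b → Dec (P b)) → Dec (∀ b → P b)
all-Bool? P? = map′ (λ (p , q) → λ { true → p ; false → q }) (λ p → p true , p false) (P? true ×-dec P? false)

decide : {A : Set} (a? : Dec A) → does a? ≡ true → A
decide (yes a) _ = a

permutations : ∀ n → List (Vec (Fin n) n)
permutations zero    = [] ∷ []
permutations (suc n) =
  concatMap (λ p → map (λ i → insertAt (Data.Vec.map suc p) i zero) (allFin (suc n))) (permutations n)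

index : ∀ {n} → Vec Bool n → Fin (2 ^ n)
index []      = zero
index (b ∷ v) = combine (bit b) (index v)
  where
  bit : Bool → Fin 2
  bit b = if b then suc zero else zero

truthTable : ∀ {n} → Vec Bool (2 ^ n) → Vec Bool n → Bool
truthTable t v = lookup t (index v)

offDiagonal : ∀ {m} → (Fin (suc m) → Fin (suc m) → Bool) → Vec (Vec Bool m) (suc m)
offDiagonal B = tabulate λ i → tabulate λ j → B i (punchIn i j)

matrix : ∀ {m} → Vec (Vec Bool m) (suc m) → Fin (suc m) → Fin (suc m) → Bool
matrix rows i = lookup (insertAt (lookup rows i) i false)

matrix-offDiagonal : ∀ {m} (B : Fin (suc m) → Fin (suc m) → Bool) {i j} → i ≢ j →
  matrix (offDiagonal B) i j ≡ B i j
matrix-offDiagonal {m} B {i} {j} i≢j = begin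
  lookup (insertAt row i false) j                         ≡⟨ cong (lookup (insertAt row i false)) (punchIn-punchOut i≢j) ⟨
  lookup (insertAt row i false) (punchIn i (punchOut i≢j)) ≡⟨ insertAt-punchIn row i false (punchOut i≢j) ⟩
  lookup row (punchOut i≢j)
    ≡⟨ cong (λ r → lookup r (punchOut i≢j)) (lookup∘tabulate (λ i → tabulate λ j → B i (punchIn i j)) i) ⟩
  lookup (tabulate λ j → B i (punchIn i j)) (punchOut i≢j) ≡⟨ lookup∘tabulate (λ j → B i (punchIn i j)) (punchOut i≢j) ⟩
  B i (punchIn i (punchOut i≢j))                          ≡⟨ cong (B i) (punchIn-punchOut i≢j) ⟩
  B i j                                                   ∎
  where
  open ≡-Reasoning
  row : Vec Bool m
  row = lookup (offDiagonal B) i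

-- The Naji equations

NajiEdge : (a b b′ : Bool) → Set
NajiEdge a b b′ = a ≡ true → b xor b′ ≡ true

NajiTriple : (avw axv axw bxv bxw bvw bwv : Bool) → Set
NajiTriple avw axv axw bxv bxw bvw bwv =
  (avw ≡ true → axv ≡ false → axw ≡ false → bxv xor bxw ≡ false) ×
  (axv ≡ true → axw ≡ true → avw ≡ false → (bvw xor bwv) xor (bxv xor bxw) ≡ true)

najiEdge-cong : ∀ {a a′ b b′ c c′} → a ≡ a′ → b ≡ b′ → c ≡ c′ → NajiEdge a b c → NajiEdge a′ b′ c′
najiEdge-cong refl refl refl edge = edge

najiTriple-cong : ∀ {a₁ a₂ a₃ b₁ b₂ b₃ b₄ a₁′ a₂′ a₃′ b₁′ b₂′ b₃′ b₄′} →
  a₁ ≡ a₁′ → a₂ ≡ a₂′ → a₃ ≡ a₃′ → b₁ ≡ b₁′ → b₂ ≡ b₂′ → b₃ ≡ b₃′ → b₄ ≡ b₄′ →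
  NajiTriple a₁ a₂ a₃ b₁ b₂ b₃ b₄ → NajiTriple a₁′ a₂′ a₃′ b₁′ b₂′ b₃′ b₄′
najiTriple-cong refl refl refl refl refl refl refl triple = triple

najiEdge? : ∀ a b b′ → Dec (NajiEdge a b b′)
najiEdge? a b b′ = a ≟ᵇ true →-dec b xor b′ ≟ᵇ true

najiTriple? : ∀ avw axv axw bxv bxw bvw bwv → Dec (NajiTriple avw axv axw bxv bxw bvw bwv)
najiTriple? avw axv axw bxv bxw bvw bwv =
  (avw ≟ᵇ true →-dec axv ≟ᵇ false →-dec axw ≟ᵇ false →-dec bxv xor bxw ≟ᵇ false) ×-dec
  (axv ≟ᵇ true →-dec axw ≟ᵇ true →-dec avw ≟ᵇ false →-dec (bvw xor bwv) xor (bxv xor bxw) ≟ᵇ true)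

module _ {n} (G : Graph n) (β : Fin n → Fin n → Bool) where

  NajiEdges : Set
  NajiEdges = ∀ v w → NajiEdge (adj G v w) (β v w) (β w v)

  NajiTriples : Set
  NajiTriples = ∀ x v w → x ≢ v → x ≢ w → v ≢ w →
    NajiTriple (adj G v w) (adj G x v) (adj G x w) (β x v) (β x w) (β v w) (β w v)

  naji-intro : NajiEdges → NajiTriples → NajiSolution G β
  naji-intro edges triples = record
    { eq1 = edges
    ; eq2 = λ x v w x≢v x≢w v≢w → proj₁ (triples x v w x≢v x≢w v≢w)
    ; eq3 = λ x v w x≢v x≢w v≢w → proj₂ (triples x v w x≢v x≢w v≢w) }

  naji-triples : NajiSolution G β → NajiTriples
  naji-triples N x v w x≢v x≢w v≢w = eq2 x v w x≢v x≢w v≢w , eq3 x v w x≢v x≢w v≢w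
    where open NajiSolution N

  naji? : Dec (NajiSolution G β)
  naji? = map′ (λ (e , t) → naji-intro e t) (λ N → NajiSolution.eq1 N , naji-triples N) (edges? ×-dec triples?)
    where
    edges? : Dec NajiEdges
    edges? = all? λ v → all? λ w → najiEdge? (adj G v w) (β v w) (β w v)
    triples? : Dec NajiTriples
    triples? = all? λ x → all? λ v → all? λ w → ¬? (x ≟ v) →-dec ¬? (x ≟ w) →-dec ¬? (v ≟ w) →-dec
      najiTriple? (adj G v w) (adj G x v) (adj G x w) (β x v) (β x w) (β v w) (β w v)

naji-triple : ∀ {n} {G : Graph n} {β} → NajiSolution G β → ∀ {x v w} → x ≢ v → x ≢ w → v ≢ w →
  NajiTriple (adj G v w) (adj G x v) (adj G x w) (β x v) (β x w) (β v w) (β w v)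
naji-triple {G = G} {β} N = naji-triples G β N _ _ _

naji-cong : ∀ {n} {G G′ : Graph n} {β β′} → (∀ v w → adj G v w ≡ adj G′ v w) →
  (∀ v w → v ≢ w → β v w ≡ β′ v w) → NajiSolution G β → NajiSolution G′ β′
naji-cong {G = G} {G′} {β} {β′} adj≡ β≡ N = naji-intro G′ β′ edges triples
  where
  edges : NajiEdges G′ β′
  edges v w vw∈E with v ≟ w
  ... | yes refl = contradiction (trans (sym vw∈E) (irref G′ v)) λ ()
  ... | no v≢w rewrite sym (β≡ v w v≢w) | sym (β≡ w v (v≢w ∘ sym)) =
    NajiSolution.eq1 N v w (trans (adj≡ v w) vw∈E)
  triples : NajiTriples G′ β′
  triples x v w x≢v x≢w v≢w
    rewrite sym (adj≡ v w) | sym (adj≡ x v) | sym (adj≡ x w)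
          | sym (β≡ x v x≢v) | sym (β≡ x w x≢w) | sym (β≡ v w v≢w) | sym (β≡ w v (v≢w ∘ sym))
    = naji-triple N x≢v x≢w v≢w

naji-induced : ∀ {k n} {G : Graph n} {β} (g : Fin k → Fin n) → Injective g →
  NajiSolution G β → NajiSolution (induced G g) (λ x y → β (g x) (g y))
naji-induced {G = G} {β} g g-inj N = naji-intro (induced G g) _
  (λ v w → NajiSolution.eq1 N (g v) (g w))
  (λ x v w x≢v x≢w v≢w → naji-triple N (x≢v ∘ g-inj x v) (x≢w ∘ g-inj x w) (v≢w ∘ g-inj v w))

naji-xor : ∀ {n} {G : Graph n} {β} c → NajiSolution G β → NajiSolution G (λ u v → c xor β u v)
naji-xor false N = N
naji-xor {G = G} {β} true N = naji-intro G _
  (λ v w vw∈E → trans (xor-annihilates-not (β v w) (β w v)) (NajiSolution.eq1 N v w vw∈E))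
  (λ x v w x≢v x≢w v≢w → let (eq₂ , eq₃) = naji-triple N x≢v x≢w v≢w in
    (λ p q r → trans (xor-annihilates-not (β x v) (β x w)) (eq₂ p q r)) ,
    (λ p q r → trans (cong₂ _xor_ (xor-annihilates-not (β v w) (β w v)) (xor-annihilates-not (β x v) (β x w)))
                      (eq₃ p q r)))

module _ {m n} {H : Graph m} {P : Graph n} (I : Iso H P) where
  open Iso I

  to-injective : Injective to
  to-injective v w eq = trans (sym (from-to v)) (trans (cong from eq) (from-to w))

  from-injective : Injective from
  from-injective v w eq = trans (sym (to-from v)) (trans (cong to eq) (to-from w))

  chordal-iso : ∀ {β} → Chordal P β → Chordal H (λ x y → β (to x) (to y))
  chordal-iso (D , D-realizes , β≡βC) =
    D′ , (λ v w → trans (sym (preserves v w)) (D-realizes (to v) (to w))) ,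
    λ v w v≢w → β≡βC (to v) (to w) (v≢w ∘ to-injective v w)
    where
    D′ : OCD m
    D′ = record
      { tail = tail D ∘ to ; head = head D ∘ to
      ; tail-inj = λ v w eq → to-injective v w (tail-inj D (to v) (to w) eq)
      ; head-inj = λ v w eq → to-injective v w (head-inj D (to v) (to w) eq)
      ; tail≢head = λ v w → tail≢head D (to v) (to w) }

chordal-cong : ∀ {n} {G : Graph n} {β β′} → (∀ v w → v ≢ w → β v w ≡ β′ v w) → Chordal G β → Chordal G β′
chordal-cong β≡ (D , D-realizes , β≡βC) = D , D-realizes , λ v w v≢w → trans (sym (β≡ v w v≢w)) (β≡βC v w v≢w)

CompleteAcross : ∀ {n} → Graph n → (side X₀ Y₀ : Fin n → Bool) → Set
CompleteAcross G side X₀ Y₀ = ∀ x y → side x ≡ true → side y ≡ false → adj G x y ≡ X₀ x ∧ Y₀ y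

CompleteBipartiteCut : ∀ {n} → Graph n → (side : Fin n → Bool) → Set
CompleteBipartiteCut G side = ∃₂ λ X₀ Y₀ → CompleteAcross G side X₀ Y₀

completeBipartiteCut-xor : ∀ {n} {G : Graph n} {side} s → CompleteBipartiteCut G side →
  CompleteBipartiteCut G (λ v → s xor side v)
completeBipartiteCut-xor false cut = cut
completeBipartiteCut-xor {G = G} true (X₀ , Y₀ , complete) = Y₀ , X₀ , λ x y x∈X y∈Y →
  trans (Graph.sym G x y)
    (trans (complete y x (not-injective y∈Y) (not-injective x∈X)) (∧-comm (X₀ y) (Y₀ x)))

split-extend : ∀ {k n} {G : Graph n} {f : Fin k → Fin n} {side side′} → Injective f →
  Split (induced G f) side → (∀ i → side′ (f i) ≡ side i) → CompleteBipartiteCut G side′ → Split G side′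
split-extend {f = f} f-inj split side′∘f≡side (X₀ , Y₀ , complete) = record
  { x₁ = f x₁ ; x₂ = f x₂ ; y₁ = f y₁ ; y₂ = f y₂
  ; x₁≢x₂ = x₁≢x₂ ∘ f-inj x₁ x₂ ; y₁≢y₂ = y₁≢y₂ ∘ f-inj y₁ y₂
  ; x₁∈X = trans (side′∘f≡side x₁) x₁∈X ; x₂∈X = trans (side′∘f≡side x₂) x₂∈X
  ; y₁∈Y = trans (side′∘f≡side y₁) y₁∈Y ; y₂∈Y = trans (side′∘f≡side y₂) y₂∈Y
  ; X₀ = X₀ ; Y₀ = Y₀
  ; complete = λ x y x∈X y∈Y → let e = complete x y x∈X y∈Y in mk⇔ (trans (sym e)) (trans e) }
  where open Split split using (x₁; x₂; y₁; y₂; x₁≢x₂; y₁≢y₂; x₁∈X; x₂∈X; y₁∈Y; y₂∈Y)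

TwoWith : ∀ {n} → (Fin n → Bool) → Bool → Set
TwoWith side b = ∃₂ λ v w → v ≢ w × side v ≡ b × side w ≡ b

Balanced : ∀ {n} → (Fin n → Bool) → Set
Balanced side = TwoWith side true × TwoWith side false

split-balanced : ∀ {n} {G : Graph n} {side} → Split G side → Balanced side
split-balanced split = (x₁ , x₂ , x₁≢x₂ , x₁∈X , x₂∈X) , (y₁ , y₂ , y₁≢y₂ , y₁∈Y , y₂∈Y)
  where open Split split

balanced-transport : ∀ {m n} {side : Fin m → Bool} {side′ : Fin n → Bool} (h : Fin m → Fin n) → Injective h →
  (∀ x → side′ (h x) ≡ side x) → Balanced side → Balanced side′
balanced-transport h h-inj side′∘h ((x₁ , x₂ , x₁≢x₂ , x₁∈X , x₂∈X) , (y₁ , y₂ , y₁≢y₂ , y₁∈Y , y₂∈Y)) =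
  (h x₁ , h x₂ , x₁≢x₂ ∘ h-inj x₁ x₂ , trans (side′∘h x₁) x₁∈X , trans (side′∘h x₂) x₂∈X) ,
  (h y₁ , h y₂ , y₁≢y₂ ∘ h-inj y₁ y₂ , trans (side′∘h y₁) y₁∈Y , trans (side′∘h y₂) y₂∈Y)

balanced? : ∀ {n} (side : Fin n → Bool) → Dec (Balanced side)
balanced? side = twoWith? true ×-dec twoWith? false
  where
  twoWith? : ∀ b → Dec (TwoWith side b)
  twoWith? b = any? λ v → any? λ w → ¬? (v ≟ w) ×-dec side v ≟ᵇ b ×-dec side w ≟ᵇ b

-- Profiles of the vertices outside H

-- For a vertex v outside H, the values adj(v, h), β(v, h) and β(h, v) for the four vertices h of H.
record Profile : Set where
  constructor profile
  field
    adjacent outgoing incoming : Vec Bool 4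
open Profile

allProfiles : List Profile
allProfiles =
  cartesianProductWith (λ a (o , i) → profile a o i) (allBoolVecs 4) (cartesianProduct (allBoolVecs 4) (allBoolVecs 4))

∈-allProfiles : ∀ d → d ∈ allProfiles
∈-allProfiles (profile a o i) =
  ∈-cartesianProductWith⁺ (λ a (o , i) → profile a o i)
    {xs = allBoolVecs 4} {ys = cartesianProduct (allBoolVecs 4) (allBoolVecs 4)} (∈-allBoolVecs a)
    (∈-cartesianProduct⁺ {xs = allBoolVecs 4} {ys = allBoolVecs 4} (∈-allBoolVecs o) (∈-allBoolVecs i))

module Profiles (P : Graph 4) (B : Fin 4 → Fin 4 → Bool) where

  -- The Naji equations of the edges and triples through the new vertex.  A triple with apex in H
  -- and the new vertex last is the same equation as with the new vertex second.
  Consistent : Profile → Set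
  Consistent (profile a o i) =
    (∀ k → NajiEdge (lookup a k) (lookup o k) (lookup i k)) ×
    (∀ k l → k ≢ l → NajiTriple (adj P k l) (lookup a k) (lookup a l) (lookup o k) (lookup o l) (B k l) (B l k)) ×
    (∀ k l → k ≢ l → NajiTriple (lookup a l) (lookup a k) (adj P k l) (lookup i k) (B k l) (lookup o l) (lookup i l))

  consistent? : ∀ d → Dec (Consistent d)
  consistent? (profile a o i) =
    (all? λ k → najiEdge? (lookup a k) (lookup o k) (lookup i k)) ×-dec
    (all? λ k → all? λ l → ¬? (k ≟ l) →-dec
      najiTriple? (adj P k l) (lookup a k) (lookup a l) (lookup o k) (lookup o l) (B k l) (B l k)) ×-dec
    (all? λ k → all? λ l → ¬? (k ≟ l) →-dec
      najiTriple? (lookup a l) (lookup a k) (adj P k l) (lookup i k) (B k l) (lookup o l) (lookup i l))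

  consistentProfiles : List Profile
  consistentProfiles = filter consistent? allProfiles

  -- The Naji equations through two new vertices x and y, where e = adj(x, y), b = β(x, y) and
  -- b′ = β(y, x).
  PairConsistent : Profile → Profile → (e b b′ : Bool) → Set
  PairConsistent (profile a o i) (profile a′ o′ i′) e b b′ =
    NajiEdge e b b′ ×
    (∀ k → NajiTriple e (lookup a k) (lookup a′ k) (lookup i k) (lookup i′ k) b b′ ×
           NajiTriple (lookup a′ k) e (lookup a k) b (lookup o k) (lookup o′ k) (lookup i′ k) ×
           NajiTriple (lookup a k) e (lookup a′ k) b′ (lookup o′ k) (lookup o k) (lookup i k))

  pairConsistent? : ∀ d d′ e b b′ → Dec (PairConsistent d d′ e b b′)
  pairConsistent? (profile a o i) (profile a′ o′ i′) e b b′ =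
    najiEdge? e b b′ ×-dec
    (all? λ k → najiTriple? e (lookup a k) (lookup a′ k) (lookup i k) (lookup i′ k) b b′ ×-dec
                najiTriple? (lookup a′ k) e (lookup a k) b (lookup o k) (lookup o′ k) (lookup i′ k) ×-dec
                najiTriple? (lookup a k) e (lookup a′ k) b′ (lookup o′ k) (lookup o k) (lookup i k))

-- The restriction of β to H and the split of H, a rule assigning a side to every vertex from its
-- incoming profile, and the vertices x₀ ∈ X and y₀ ∈ Y whose neighbourhoods give Y₀ and X₀.
record CertificateData : Set where
  field
    β-rows : Vec (Vec Bool 3) 4
    sides : Vec Bool 4
    rule-table : Vec Bool 16
    x₀ y₀ : Fin 4

module Certified (P : Graph 4) (C : CertificateData) where
  open CertificateData C public

  B : Fin 4 → Fin 4 → Bool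
  B = matrix β-rows

  S : Fin 4 → Bool
  S = lookup sides

  rule : Vec Bool 4 → Bool
  rule = truthTable rule-table

  -- The incoming profile of the vertex k of H, whose entry β(k, k) is arbitrary.
  column : Fin 4 → Bool → Vec Bool 4
  column k b = tabulate λ i → if does (i ≟ k) then b else B i k

  open Profiles P B public

  OnSide : Bool → List Profile → List Profile
  OnSide b = filter λ d → rule (incoming d) ≟ᵇ b

  CutFromX : Profile → Set
  CutFromX d = ∀ l → S l ≡ false → lookup (adjacent d) l ≡ lookup (adjacent d) y₀ ∧ adj P l x₀

  CutToY : Profile → Set
  CutToY d = ∀ k → S k ≡ true → lookup (adjacent d) k ≡ adj P k y₀ ∧ lookup (adjacent d) x₀

  -- The adjacency of an outside X-vertex to an outside Y-vertex is forced by the Naji equations.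
  CutBetween : Profile → Profile → Set
  CutBetween d d′ = ∀ b b′ → ¬ PairConsistent d d′ (not (lookup (adjacent d) y₀ ∧ lookup (adjacent d′) x₀)) b b′

  cutFromX? : ∀ d → Dec (CutFromX d)
  cutFromX? d = all? λ l → S l ≟ᵇ false →-dec lookup (adjacent d) l ≟ᵇ lookup (adjacent d) y₀ ∧ adj P l x₀

  cutToY? : ∀ d → Dec (CutToY d)
  cutToY? d = all? λ k → S k ≟ᵇ true →-dec lookup (adjacent d) k ≟ᵇ adj P k y₀ ∧ lookup (adjacent d) x₀

  cutBetween? : ∀ d d′ → Dec (CutBetween d d′)
  cutBetween? d d′ = all-Bool? λ b → all-Bool? λ b′ →
    ¬? (pairConsistent? d d′ (not (lookup (adjacent d) y₀ ∧ lookup (adjacent d′) x₀)) b b′)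

  record Valid : Set where
    field
      rule-on-H     : ∀ k b → rule (column k b) ≡ S k
      complete-on-H : ∀ k l → S k ≡ true → S l ≡ false → adj P k l ≡ adj P k y₀ ∧ adj P l x₀
      cut-from-X    : All CutFromX (OnSide true consistentProfiles)
      cut-to-Y      : All CutToY (OnSide false consistentProfiles)
      cut-between   : All (λ d → All (CutBetween d) (OnSide false consistentProfiles)) (OnSide true consistentProfiles)

  valid? : Dec Valid
  valid? =
    map′ (λ (r , h , x , y , xy) →
           record { rule-on-H = r ; complete-on-H = h ; cut-from-X = x ; cut-to-Y = y ; cut-between = xy })
         (λ V → let open Valid V in rule-on-H , complete-on-H , cut-from-X , cut-to-Y , cut-between)
         (rule-on-H? ×-dec complete-on-H? ×-dec outside? consistentProfiles)
    where
    rule-on-H? : Dec (∀ k b → rule (column k b) ≡ S k)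
    rule-on-H? = all? λ k → all-Bool? λ b → rule (column k b) ≟ᵇ S k
    complete-on-H? : Dec (∀ k l → S k ≡ true → S l ≡ false → adj P k l ≡ adj P k y₀ ∧ adj P l x₀)
    complete-on-H? = all? λ k → all? λ l →
      S k ≟ᵇ true →-dec S l ≟ᵇ false →-dec adj P k l ≟ᵇ adj P k y₀ ∧ adj P l x₀
    -- Taking the profiles as an argument makes the evaluator compute them only once.
    outside? : ∀ L → Dec (All CutFromX (OnSide true L) × All CutToY (OnSide false L) ×
                          All (λ d → All (CutBetween d) (OnSide false L)) (OnSide true L))
    outside? L = All.all? cutFromX? _ ×-dec All.all? cutToY? _ ×-dec All.all? (λ d → All.all? (cutBetween? d) _) _

Certificate : Graph 4 → Set
Certificate P = Σ CertificateData (Certified.Valid P)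

certify : ∀ {P} C → does (Certified.valid? P C) ≡ true → Certificate P
certify {P} C checked = C , decide (Certified.valid? P C) checked

module CertifiedSplit {P : Graph 4} (C : CertificateData) (valid : Certified.Valid P C)
  {n} {G : Graph n} {β} (N : NajiSolution G β) (f : Fin 4 → Fin n) (f-inj : Injective f)
  (adj-f : ∀ k l → adj G (f k) (f l) ≡ adj P k l)
  (β-f : ∀ k l → k ≢ l → β (f k) (f l) ≡ Certified.B P C k l) where

  open Certified P C
  open Valid valid
  open ≡-Reasoning

  profileOf : Fin n → Profile
  profileOf v = profile (tabulate λ k → adj G v (f k)) (tabulate λ k → β v (f k)) (tabulate λ k → β (f k) v)

  side : Fin n → Bool
  side v = rule (incoming (profileOf v))

  X₀ Y₀ : Fin n → Bool
  X₀ v = adj G v (f y₀)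
  Y₀ v = adj G v (f x₀)

  adjacent-at : ∀ v k → lookup (adjacent (profileOf v)) k ≡ adj G v (f k)
  adjacent-at v = lookup∘tabulate (λ k → adj G v (f k))

  outgoing-at : ∀ v k → lookup (outgoing (profileOf v)) k ≡ β v (f k)
  outgoing-at v = lookup∘tabulate (λ k → β v (f k))

  incoming-at : ∀ v k → lookup (incoming (profileOf v)) k ≡ β (f k) v
  incoming-at v = lookup∘tabulate (λ k → β (f k) v)

  f-distinct : ∀ {k l} → k ≢ l → f k ≢ f l
  f-distinct k≢l = k≢l ∘ f-inj _ _

  consistent : ∀ v → (∀ k → v ≢ f k) → Consistent (profileOf v)
  consistent v v∉H =
    (λ k → najiEdge-cong (sym (adjacent-at v k)) (sym (outgoing-at v k)) (sym (incoming-at v k))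
             (NajiSolution.eq1 N v (f k))) ,
    (λ k l k≢l → najiTriple-cong (adj-f k l) (sym (adjacent-at v k)) (sym (adjacent-at v l))
                   (sym (outgoing-at v k)) (sym (outgoing-at v l)) (β-f k l k≢l) (β-f l k (k≢l ∘ sym))
                   (naji-triple N (v∉H k) (v∉H l) (f-distinct k≢l))) ,
    (λ k l k≢l → najiTriple-cong (sym (adjacent-at v l)) (trans (Graph.sym G (f k) v) (sym (adjacent-at v k))) (adj-f k l)
                   (sym (incoming-at v k)) (β-f k l k≢l) (sym (outgoing-at v l)) (sym (incoming-at v l))
                   (naji-triple N (v∉H k ∘ sym) (f-distinct k≢l) (v∉H l)))

  pairConsistent : ∀ x y → (∀ k → x ≢ f k) → (∀ k → y ≢ f k) → x ≢ y →
    PairConsistent (profileOf x) (profileOf y) (adj G x y) (β x y) (β y x)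
  pairConsistent x y x∉H y∉H x≢y = NajiSolution.eq1 N x y , λ k →
    najiTriple-cong (refl {x = adj G x y})
      (trans (Graph.sym G (f k) x) (sym (adjacent-at x k))) (trans (Graph.sym G (f k) y) (sym (adjacent-at y k)))
      (sym (incoming-at x k)) (sym (incoming-at y k)) (refl {x = β x y}) (refl {x = β y x})
      (naji-triple N (x∉H k ∘ sym) (y∉H k ∘ sym) x≢y) ,
    najiTriple-cong (sym (adjacent-at y k)) (refl {x = adj G x y}) (sym (adjacent-at x k))
      (refl {x = β x y}) (sym (outgoing-at x k)) (sym (outgoing-at y k)) (sym (incoming-at y k))
      (naji-triple N x≢y (x∉H k) (y∉H k)) ,
    najiTriple-cong (sym (adjacent-at x k)) (Graph.sym G y x) (sym (adjacent-at y k))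
      (refl {x = β y x}) (sym (outgoing-at y k)) (sym (outgoing-at x k)) (sym (incoming-at x k))
      (naji-triple N (x≢y ∘ sym) (y∉H k) (x∉H k))

  ∈-OnSide : ∀ {v b} → (∀ k → v ≢ f k) → side v ≡ b → profileOf v ∈ OnSide b consistentProfiles
  ∈-OnSide {v} v∉H v∈b = ∈-filter⁺ _ (∈-filter⁺ consistent? (∈-allProfiles _) (consistent v v∉H)) v∈b

  side-f : ∀ k → side (f k) ≡ S k
  side-f k = trans (cong rule (tabulate-cong entry)) (rule-on-H k (β (f k) (f k)))
    where
    entry : ∀ i → β (f i) (f k) ≡ (if does (i ≟ k) then β (f k) (f k) else B i k)
    entry i with i ≟ k
    ... | yes refl = refl
    ... | no i≢k   = β-f i k i≢k

  complete-HH : ∀ k l → S k ≡ true → S l ≡ false → adj G (f k) (f l) ≡ X₀ (f k) ∧ Y₀ (f l)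
  complete-HH k l k∈X l∈Y rewrite adj-f k l | adj-f k y₀ | adj-f l x₀ = complete-on-H k l k∈X l∈Y

  complete-OH : ∀ x l → (∀ k → x ≢ f k) → side x ≡ true → S l ≡ false → adj G x (f l) ≡ X₀ x ∧ Y₀ (f l)
  complete-OH x l x∉H x∈X l∈Y = begin
    adj G x (f l)                                   ≡⟨ sym (adjacent-at x l) ⟩
    lookup (adjacent d) l                           ≡⟨ All.lookup cut-from-X (∈-OnSide x∉H x∈X) l l∈Y ⟩
    lookup (adjacent d) y₀ ∧ adj P l x₀             ≡⟨ cong₂ _∧_ (adjacent-at x y₀) (sym (adj-f l x₀)) ⟩
    X₀ x ∧ Y₀ (f l)                                 ∎
    where d = profileOf x

  complete-HO : ∀ k y → (∀ l → y ≢ f l) → S k ≡ true → side y ≡ false → adj G (f k) y ≡ X₀ (f k) ∧ Y₀ y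
  complete-HO k y y∉H k∈X y∈Y = begin
    adj G (f k) y                                   ≡⟨ Graph.sym G (f k) y ⟩
    adj G y (f k)                                   ≡⟨ sym (adjacent-at y k) ⟩
    lookup (adjacent d) k                           ≡⟨ All.lookup cut-to-Y (∈-OnSide y∉H y∈Y) k k∈X ⟩
    adj P k y₀ ∧ lookup (adjacent d) x₀             ≡⟨ cong₂ _∧_ (sym (adj-f k y₀)) (adjacent-at y x₀) ⟩
    X₀ (f k) ∧ Y₀ y                                 ∎
    where d = profileOf y

  complete-OO : ∀ x y → (∀ k → x ≢ f k) → (∀ k → y ≢ f k) → side x ≡ true → side y ≡ false →
    adj G x y ≡ X₀ x ∧ Y₀ y
  complete-OO x y x∉H y∉H x∈X y∈Y with adj G x y ≟ᵇ X₀ x ∧ Y₀ y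
  ... | yes forced = forced
  ... | no unforced =
    contradiction (subst (λ e → PairConsistent d d′ e (β x y) (β y x)) xy≡ (pairConsistent x y x∉H y∉H x≢y))
                  (All.lookup (All.lookup cut-between (∈-OnSide x∉H x∈X)) (∈-OnSide y∉H y∈Y) (β x y) (β y x))
    where
    d = profileOf x
    d′ = profileOf y
    x≢y : x ≢ y
    x≢y refl = contradiction (trans (sym x∈X) y∈Y) λ ()
    xy≡ : adj G x y ≡ not (lookup (adjacent d) y₀ ∧ lookup (adjacent d′) x₀)
    xy≡ = trans (¬-not unforced) (cong not (sym (cong₂ _∧_ (adjacent-at x y₀) (adjacent-at y x₀))))

  complete : CompleteAcross G side X₀ Y₀
  complete x y x∈X y∈Y with any? (λ k → x ≟ f k) | any? (λ l → y ≟ f l)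
  ... | yes (k , refl) | yes (l , refl) = complete-HH k l (trans (sym (side-f k)) x∈X) (trans (sym (side-f l)) y∈Y)
  ... | yes (k , refl) | no y∉H         = complete-HO k y (λ l → y∉H ∘ (l ,_)) (trans (sym (side-f k)) x∈X) y∈Y
  ... | no x∉H         | yes (l , refl) = complete-OH x l (λ k → x∉H ∘ (k ,_)) x∈X (trans (sym (side-f l)) y∈Y)
  ... | no x∉H         | no y∉H         = complete-OO x y (λ k → x∉H ∘ (k ,_)) (λ l → y∉H ∘ (l ,_)) x∈X y∈Y

-- Chord diagrams and the classification of the Naji solutions on H

Endpoints : Set
Endpoints = Vec ℕ 4 × Vec ℕ 4

IsDiagram : Endpoints → Set
IsDiagram (t , h) =
  (∀ v w → lookup t v ≡ lookup t w → v ≡ w) × (∀ v w → lookup h v ≡ lookup h w → v ≡ w) ×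
  (∀ v w → lookup t v ≢ lookup h w)

toOCD : (e : Endpoints) → IsDiagram e → OCD 4
toOCD (t , h) (t-inj , h-inj , t≢h) = record
  { tail = lookup t ; head = lookup h ; tail-inj = t-inj ; head-inj = h-inj ; tail≢head = t≢h }

-- βC and crosses of the diagram with these endpoints, available before the endpoints are known to
-- be distinct, so that a search can discard wrong candidates cheaply.
βᵉ : Endpoints → Fin 4 → Fin 4 → Bool
βᵉ (t , h) v w = not (inArc (lookup h v) (lookup t v) (lookup h w))

crossesᵉ : Endpoints → Fin 4 → Fin 4 → Bool
crossesᵉ (t , h) v w = inArc (lookup h v) (lookup t v) (lookup h w) xor inArc (lookup h v) (lookup t v) (lookup t w)

Realizes : Graph 4 → (Fin 4 → Fin 4 → Bool) → Endpoints → Set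
Realizes P β e = (∀ v w → v ≢ w → β v w ≡ βᵉ e v w) × (∀ v w → adj P v w ≡ crossesᵉ e v w) × IsDiagram e

realizes? : ∀ P β e → Dec (Realizes P β e)
realizes? P β (t , h) =
  (all? λ v → all? λ w → ¬? (v ≟ w) →-dec β v w ≟ᵇ βᵉ (t , h) v w) ×-dec
  (all? λ v → all? λ w → adj P v w ≟ᵇ crossesᵉ (t , h) v w) ×-dec
  (all? λ v → all? λ w → lookup t v ℕ.≟ lookup t w →-dec v ≟ w) ×-dec
  (all? λ v → all? λ w → lookup h v ℕ.≟ lookup h w →-dec v ≟ w) ×-dec
  (all? λ v → all? λ w → ¬? (lookup t v ℕ.≟ lookup h w))

realizes⇒chordal : ∀ {P β} e → Realizes P β e → Chordal P β
realizes⇒chordal e (β≡βC , crossing , D) = toOCD e D , crossing , β≡βC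

-- Up to rotation, a diagram of K4 or of the claw has chord 0 from 0 to 4, and chord k + 1 joins a
-- point s ∈ {1, 2, 3} to its partner: s + 4 if the chords cross pairwise, 8 ∸ s if they are nested.
diagrams : (ℕ → ℕ) → List Endpoints
diagrams partner = concatMap (λ σ → map (diagram σ) (allBoolVecs 3)) (permutations 3)
  where
  diagram : Vec (Fin 3) 3 → Vec Bool 3 → Endpoints
  diagram σ o = 0 ∷ tabulate tail′ , 4 ∷ tabulate head′
    where
    slot : Fin 3 → ℕ
    slot k = suc (toℕ (lookup σ k))
    tail′ head′ : Fin 3 → ℕ
    tail′ k = if lookup o k then slot k else partner (slot k)
    head′ k = if lookup o k then partner (slot k) else slot k

record Transform (P : Graph 4) : Set where
  field
    π : Vec (Fin 4) 4
    complemented swapped : Bool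
    certificate : Certificate P

transforms : ∀ {P} → List (Certificate P) → List (Transform P)
transforms certs =
  concatMap (λ π → concatMap (λ c → concatMap (λ s → map (transform π c s) certs) bools) bools) (permutations 4)
  where
  transform : ∀ {P} → Vec (Fin 4) 4 → Bool → Bool → Certificate P → Transform P
  transform π c s C = record { π = π ; complemented = c ; swapped = s ; certificate = C }

record IsTransform (P : Graph 4) (β : Fin 4 → Fin 4 → Bool) (side : Fin 4 → Bool) (t : Transform P) : Set where
  open Transform t
  open Certified P (proj₁ certificate) using (B; S)
  field
    sides-match  : ∀ i → swapped xor side (lookup π i) ≡ S i
    automorphism : ∀ i j → adj P (lookup π i) (lookup π j) ≡ adj P i j
    β-match      : ∀ i j → i ≢ j → complemented xor β (lookup π i) (lookup π j) ≡ B i j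
    π-injective  : ∀ i j → lookup π i ≡ lookup π j → i ≡ j
    π-surjective : ∀ j → ∃ λ i → lookup π i ≡ j

isTransform? : ∀ P β side t → Dec (IsTransform P β side t)
isTransform? P β side t =
  map′ (λ (s , a , b , i , o) →
         record { sides-match = s ; automorphism = a ; β-match = b ; π-injective = i ; π-surjective = o })
       (λ T → let open IsTransform T in sides-match , automorphism , β-match , π-injective , π-surjective)
  ((all? λ i → swapped xor side (lookup π i) ≟ᵇ S i) ×-dec
   (all? λ i → all? λ j → adj P (lookup π i) (lookup π j) ≟ᵇ adj P i j) ×-dec
   (all? λ i → all? λ j → ¬? (i ≟ j) →-dec complemented xor β (lookup π i) (lookup π j) ≟ᵇ B i j) ×-dec
   (all? λ i → all? λ j → lookup π i ≟ lookup π j →-dec i ≟ j) ×-dec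
   (all? λ j → any? λ i → lookup π i ≟ j))
  where
  open Transform t
  open Certified P (proj₁ certificate) using (B; S)

ChordalOrTransformable : (P : Graph 4) → List Endpoints → List (Transform P) → Vec (Vec Bool 3) 4 → Set
ChordalOrTransformable P Ds Ts v = NajiSolution P (matrix v) →
  Any (Realizes P (matrix v)) Ds ⊎
  All (λ S → Balanced (lookup S) → Any (IsTransform P (matrix v) (lookup S)) Ts) (allBoolVecs 4)

chordalOrTransformable? : ∀ P Ds Ts v → Dec (ChordalOrTransformable P Ds Ts v)
chordalOrTransformable? P Ds Ts v = naji? P (matrix v) →-dec
  (Any.any? (realizes? P (matrix v)) Ds ⊎-dec
   All.all? (λ S → balanced? (lookup S) →-dec Any.any? (isTransform? P (matrix v) (lookup S)) Ts) (allBoolVecs 4))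

Classification : Graph 4 → Set
Classification P = ∀ v → NajiSolution P (matrix v) →
  Chordal P (matrix v) ⊎ (∀ S → Balanced (lookup S) → Σ (Transform P) (IsTransform P (matrix v) (lookup S)))

classified? : ∀ P Ds Ts → Dec (All (ChordalOrTransformable P Ds Ts) (allVecs (allBoolVecs 3) 4))
classified? P Ds Ts = All.all? (chordalOrTransformable? P Ds Ts) (allVecs (allBoolVecs 3) 4)

classification : ∀ {P} Ds Ts → All (ChordalOrTransformable P Ds Ts) (allVecs (allBoolVecs 3) 4) → Classification P
classification {P} Ds Ts checked v naji =
  Sum.map chordal transformable
    (all-allVecs {xs = allBoolVecs 3} ∈-allBoolVecs {P = ChordalOrTransformable P Ds Ts} checked v naji)
  where
  chordal : Any (Realizes P (matrix v)) Ds → Chordal P (matrix v)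
  chordal realized = let (e , realizes) = Any.satisfied realized in realizes⇒chordal {P} {matrix v} e realizes
  transformable : All (λ S → Balanced (lookup S) → Any (IsTransform P (matrix v) (lookup S)) Ts) (allBoolVecs 4) →
    ∀ S → Balanced (lookup S) → Σ (Transform P) (IsTransform P (matrix v) (lookup S))
  transformable transformables S balanced =
    Any.satisfied (all-allVecs {xs = bools} ∈-bools
      {P = λ S → Balanced (lookup S) → Any (IsTransform P (matrix v) (lookup S)) Ts} transformables S balanced)

-- Extending the split of H

module SplitExtension {P : Graph 4} (classify : Classification P)
  {n} {G : Graph n} {β} (N : NajiSolution G β) (f : Fin 4 → Fin n) (f-inj : Injective f)
  (I : Iso (induced G f) P) where

  open Iso I
  open ≡-Reasoning

  ι : Fin 4 → Fin n
  ι = f ∘ from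

  ι-inj : Injective ι
  ι-inj k l = from-injective I k l ∘ f-inj (from k) (from l)

  adj-ι : ∀ k l → adj G (ι k) (ι l) ≡ adj P k l
  adj-ι k l = trans (sym (preserves (from k) (from l))) (cong₂ (adj P) (to-from k) (to-from l))

  B M : Fin 4 → Fin 4 → Bool
  B k l = β (ι k) (ι l)
  M = matrix (offDiagonal B)

  naji-M : NajiSolution P M
  naji-M = naji-cong adj-ι (λ k l k≢l → sym (matrix-offDiagonal B k≢l)) (naji-induced ι ι-inj N)

  chordal-H : Chordal P M → Chordal (induced G f) (λ x y → β (f x) (f y))
  chordal-H chordal-M = chordal-cong {G = induced G f} {β = λ x y → B (to x) (to y)}
    (λ x y _ → cong₂ (λ u v → β (f u) (f v)) (from-to x) (from-to y))
    (chordal-iso I (chordal-cong {G = P} {β = M} (λ k l → matrix-offDiagonal B) chordal-M))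

  Extension : (Fin 4 → Bool) → Set
  Extension side = Σ (Fin n → Bool) λ side′ → Split G side′ × (∀ i → side′ (f i) ≡ side i)

  module Transformed {S : Fin 4 → Bool} (t : Transform P) (is-t : IsTransform P M S t) where
    open Transform t
    open IsTransform is-t

    C : CertificateData
    C = proj₁ certificate

    ι′ : Fin 4 → Fin n
    ι′ = ι ∘ lookup π

    ι′-inj : Injective ι′
    ι′-inj k l = π-injective k l ∘ ι-inj (lookup π k) (lookup π l)

    adj-ι′ : ∀ k l → adj G (ι′ k) (ι′ l) ≡ adj P k l
    adj-ι′ k l = trans (adj-ι (lookup π k) (lookup π l)) (automorphism k l)

    β-ι′ : ∀ k l → k ≢ l → complemented xor β (ι′ k) (ι′ l) ≡ Certified.B P C k l
    β-ι′ k l k≢l =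
      trans (cong (complemented xor_) (sym (matrix-offDiagonal B (k≢l ∘ π-injective k l)))) (β-match k l k≢l)

    open CertifiedSplit C (proj₂ certificate) (naji-xor complemented N) ι′ ι′-inj adj-ι′ β-ι′
      using (side; side-f; X₀; Y₀; complete)

    side′ : Fin n → Bool
    side′ v = swapped xor side v

    side′-ι : ∀ j → side′ (ι j) ≡ S j
    side′-ι j with π-surjective j
    ... | k , refl = begin
      swapped xor side (ι′ k)                   ≡⟨ cong (swapped xor_) (side-f k) ⟩
      swapped xor Certified.S P C k             ≡⟨ cong (swapped xor_) (sides-match k) ⟨
      swapped xor (swapped xor S (lookup π k))  ≡⟨ xor-assoc swapped swapped _ ⟨
      (swapped xor swapped) xor S (lookup π k)  ≡⟨ cong (_xor S (lookup π k)) (xor-same swapped) ⟩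
      S (lookup π k)                            ∎

    cut′ : CompleteBipartiteCut G side′
    cut′ = completeBipartiteCut-xor {G = G} {side} swapped (X₀ , Y₀ , complete)

  module _ {side : Fin 4 → Bool} (split : Split (induced G f) side) where

    S : Vec Bool 4
    S = tabulate (side ∘ from)

    S∘to : ∀ x → lookup S (to x) ≡ side x
    S∘to x = trans (lookup∘tabulate (side ∘ from) (to x)) (cong side (from-to x))

    S-balanced : Balanced (lookup S)
    S-balanced = balanced-transport to (to-injective I) S∘to (split-balanced split)

    extend-by : Σ (Transform P) (IsTransform P M (lookup S)) → Extension side
    extend-by (t , is-t) = side′ , split-extend f-inj split side′∘f cut′ , side′∘f
      where
      open Transformed t is-t
      side′∘f : ∀ i → side′ (f i) ≡ side i
      side′∘f i = begin
        side′ (f i)       ≡⟨ cong (side′ ∘ f) (from-to i) ⟨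
        side′ (ι (to i))  ≡⟨ side′-ι (to i) ⟩
        lookup S (to i)   ≡⟨ S∘to i ⟩
        side i            ∎

  extend : ¬ Chordal (induced G f) (λ x y → β (f x) (f y)) → ∀ {side} → Split (induced G f) side → Extension side
  extend nonchordal split with classify (offDiagonal B) naji-M
  ... | inj₁ chordal      = contradiction (chordal-H chordal) nonchordal
  ... | inj₂ transformable = extend-by split (transformable (S split) (S-balanced split))

β₁ β₂ : Vec (Vec Bool 3) 4
β₁ = (false ∷ false ∷ false ∷ []) ∷ (true ∷ false ∷ true ∷ [])
   ∷ (true ∷ true ∷ false ∷ [])   ∷ (true ∷ false ∷ true ∷ []) ∷ []
β₂ = (false ∷ false ∷ true ∷ []) ∷ (true ∷ false ∷ true ∷ [])
   ∷ (true ∷ true ∷ false ∷ [])  ∷ (false ∷ true ∷ false ∷ []) ∷ []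

K4-certificate : Certificate K4
K4-certificate = certify record
  { β-rows = β₁ ; sides = false ∷ false ∷ true ∷ true ∷ []
  ; rule-table = false ∷ true ∷ false ∷ true ∷ true ∷ true ∷ false ∷ false
                 ∷ false ∷ false ∷ true ∷ true ∷ true ∷ false ∷ true ∷ false ∷ []
  ; x₀ = 2F ; y₀ = 0F } refl

claw-certificate₁ : Certificate Claw
claw-certificate₁ = certify record
  { β-rows = β₁ ; sides = false ∷ false ∷ true ∷ true ∷ []
  ; rule-table = false ∷ true ∷ false ∷ true ∷ true ∷ true ∷ false ∷ false
                 ∷ false ∷ true ∷ false ∷ true ∷ true ∷ true ∷ false ∷ false ∷ []
  ; x₀ = 2F ; y₀ = 0F } refl

claw-certificate₂ : Certificate Claw
claw-certificate₂ = certify record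
  { β-rows = β₂ ; sides = false ∷ false ∷ true ∷ true ∷ []
  ; rule-table = true ∷ false ∷ true ∷ false ∷ true ∷ true ∷ false ∷ false
                 ∷ true ∷ false ∷ true ∷ false ∷ true ∷ true ∷ false ∷ false ∷ []
  ; x₀ = 2F ; y₀ = 0F } refl

claw-certificate₃ : Certificate Claw
claw-certificate₃ = certify record
  { β-rows = β₂ ; sides = false ∷ true ∷ false ∷ true ∷ []
  ; rule-table = false ∷ false ∷ false ∷ true ∷ true ∷ true ∷ false ∷ true
                 ∷ false ∷ false ∷ false ∷ true ∷ true ∷ true ∷ false ∷ true ∷ []
  ; x₀ = 1F ; y₀ = 0F } refl

claw-certificate₄ : Certificate Claw
claw-certificate₄ = certify record
  { β-rows = β₂ ; sides = false ∷ true ∷ true ∷ false ∷ []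
  ; rule-table = true ∷ false ∷ true ∷ true ∷ false ∷ false ∷ false ∷ true
                 ∷ true ∷ false ∷ true ∷ true ∷ false ∷ false ∷ false ∷ true ∷ []
  ; x₀ = 1F ; y₀ = 0F } refl

K4-classification : Classification K4
K4-classification = classification Ds Ts (decide (classified? K4 Ds Ts) refl)
  where
  Ds : List Endpoints
  Ds = diagrams (4 +_)
  Ts : List (Transform K4)
  Ts = transforms (K4-certificate ∷ [])

claw-classification : Classification Claw
claw-classification = classification Ds Ts (decide (classified? Claw Ds Ts) refl)
  where
  Ds : List Endpoints
  Ds = diagrams (8 ∸_)
  Ts : List (Transform Claw)
  Ts = transforms (claw-certificate₁ ∷ claw-certificate₂ ∷ claw-certificate₃ ∷ claw-certificate₄ ∷ [])

lemma2p2 : {n : ℕ} (G : Graph n) (β : Fin n → Fin n → Bool) →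
    NajiSolution G β → ¬ Chordal G β →
    (f : Fin 4 → Fin n) → Injective f →
    (Iso (induced G f) K4 ⊎ Iso (induced G f) Claw) →
    ¬ Chordal (induced G f) (λ x y → β (f x) (f y)) →
    (side : Fin 4 → Bool) → Split (induced G f) side →
    Σ (Fin n → Bool) λ side′ → Split G side′ × (∀ i → side′ (f i) ≡ side i)
lemma2p2 G β N _ f f-inj (inj₁ H≅K4) nonchordal _ split =
  SplitExtension.extend K4-classification N f f-inj H≅K4 nonchordal split
lemma2p2 G β N _ f f-inj (inj₂ H≅claw) nonchordal _ split =
  SplitExtension.extend claw-classification N f f-inj H≅claw nonchordal split
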